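{- Let $T$ be a tournament and let $P = (v_0, v_1, \ldots, v_k)$, $k \ge 1$, be a shortest directed path in $T$ from $v_0$ to $v_k$, with arcs $e_i = v_{i-1}v_i$ for $1 \le i \le k$. Then: (1) each vertex in $N^-(v_0) \cap N^+(v_k)$ belongs to $N(e_i)$ for some $1 \le i \le k$; (2) if $k \ge 3$, each vertex of $P$ belongs to $N(e_i)$ for some $1 \le i \le k$; (3) if $k = 2$, then $v_0 \in N(e_2)$ and $v_2 \in N(e_1)$.
   Context: For a vertex $v$ of a tournament, $N^+(v)$ and $N^-(v)$ are its out- and in-neighbourhoods. For an arc $e = uv$, $N(e) = N^+(v) \cap N^-(u)$ (the vertices forming a directed triangle with $uv$). -}

module Defs where

open import Data.Nat using (ℕ; zero; suc; _<_)
open import Data.Fin using (Fin; zero; suc; inject₁; fromℕ)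
open import Data.Product using (_×_; Σ; ∃)
open import Data.Sum using (_⊎_)
open import Relation.Nullary using (¬_)
open import Data.Empty using (⊥)
open import Relation.Binary.PropositionalEquality using (_≡_; _≢_)
open import Function.Definitions using (Injective)

record Tournament (n : ℕ) : Set₁ where
  field
    Arc      : Fin n → Fin n → Set
    irrefl   : ∀ x → ¬ Arc x x
    total    : ∀ x y → x ≢ y → Arc x y ⊎ Arc y x
    asym     : ∀ x y → Arc x y → ¬ Arc y x

module _ {n : ℕ} (T : Tournament n) where
  open Tournament T

  N⁺ : Fin n → Fin n → Set
  N⁺ v x = Arc v x

  N⁻ : Fin n → Fin n → Set
  N⁻ v x = Arc x v

  Nₑ : Fin n → Fin n → Fin n → Set
  Nₑ u v x = N⁺ v x × N⁻ u x

  record DirPath (k : ℕ) : Set where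
    field
      vtx  : Fin (suc k) → Fin n
      inj  : Injective _≡_ _≡_ vtx
      arcs : ∀ (i : Fin k) → Arc (vtx (inject₁ i)) (vtx (suc i))

  start : ∀ {k} → DirPath k → Fin n
  start P = DirPath.vtx P zero

  end : ∀ {k} → DirPath k → Fin n
  end {k} P = DirPath.vtx P (fromℕ k)

  Shortest : ∀ {k} → DirPath k → Set
  Shortest {k} P = ∀ m → m < k → (Q : DirPath m) →
    start Q ≡ start P → end Q ≡ end P → ⊥

  -- For a path P with k arcs, arc e_i = v_{i-1} v_i for i = 1..k is indexed
  -- here by i' : Fin k with i = i'+1; its triangle-neighbourhood:
  NArc : ∀ {k} → DirPath k → Fin k → Fin n → Set
  NArc P i x = Nₑ (DirPath.vtx P (inject₁ i)) (DirPath.vtx P (suc i)) x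

-- A vertex x with x → v₀ and v_k → x must switch sides somewhere along P: at the
-- first vertex v_i dominating x, the arc v_{i-1}v_i forms a directed triangle with x.
-- A shortest path has no forward chord v_i → v_{i+2} (it could be shortcut), so every
-- such chord points backwards, v_{i+2} → v_i; hence v_i lies in the triangle of the
-- arc v_{i-2}v_{i-1} or of the arc v_{i+1}v_{i+2}, whichever exists.
module Submission where

open import Defs
open import Data.Nat using (ℕ; suc; _+_; _≤_; s≤s)
open import Data.Nat.Properties using (n<1+n)
open import Data.Fin using (Fin; zero; suc; toℕ; inject₁; fromℕ; punchIn)
open import Data.Fin.Properties using (punchIn-injective)
open import Data.Product using (_×_; ∃; _,_)
open import Data.Sum using (inj₁; inj₂)
open import Data.Empty using (⊥-elim)
open import Function using (_∘_)
open import Relation.Binary.PropositionalEquality using (_≡_; _≢_; refl; sym; cong)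

punchIn-inject₁-fromℕ : ∀ {m} (i : Fin (suc m)) → punchIn (inject₁ i) (fromℕ m) ≡ fromℕ (suc m)
punchIn-inject₁-fromℕ zero = refl
punchIn-inject₁-fromℕ {suc m} (suc i) = cong suc (punchIn-inject₁-fromℕ i)

module _ {n : ℕ} (T : Tournament n) where
  open Tournament T

  IsWalk : ∀ {k} → (Fin (suc k) → Fin n) → Set
  IsWalk v = ∀ i → Arc (v (inject₁ i)) (v (suc i))

  2-walk-ends-≢ : ∀ {x y z} → Arc x y → Arc y z → z ≢ x
  2-walk-ends-≢ xy yz refl = asym _ _ xy yz

  crossing-arc : ∀ {k} (v : Fin (suc k) → Fin n) → IsWalk v →
                 ∀ x → Arc x (v zero) → Arc (v (fromℕ k)) x →
                 ∃ λ i → Nₑ T (v (inject₁ i)) (v (suc i)) x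
  crossing-arc {ℕ.zero} v walk x x→v₀ vₖ→x = ⊥-elim (asym _ _ x→v₀ vₖ→x)
  crossing-arc {suc k} v walk x x→v₀ vₖ→x
    with total x (v (suc zero)) (2-walk-ends-≢ x→v₀ (walk zero) ∘ sym)
  ... | inj₂ v₁→x = zero , v₁→x , x→v₀
  ... | inj₁ x→v₁ with crossing-arc (v ∘ suc) (walk ∘ suc) x x→v₁ vₖ→x
  ...   | i , x∈Nₑ = suc i , x∈Nₑ

  -- punchIn (suc (inject₁ a)) skips the index a+1, so every case holds definitionally.
  shortcut-IsWalk : ∀ {m} (v : Fin (suc (suc m)) → Fin n) (a : Fin m) → IsWalk v →
                    Arc (v (inject₁ (inject₁ a))) (v (suc (suc a))) →
                    IsWalk (v ∘ punchIn (suc (inject₁ a)))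
  shortcut-IsWalk v zero walk chord zero = chord
  shortcut-IsWalk v zero walk chord (suc t) = walk (suc (suc t))
  shortcut-IsWalk v (suc a) walk chord zero = walk zero
  shortcut-IsWalk v (suc a) walk chord (suc t) = shortcut-IsWalk (v ∘ suc) a (walk ∘ suc) chord t

  shortcut : ∀ {m} (P : DirPath T (suc m)) (a : Fin m) →
             Arc (DirPath.vtx P (inject₁ (inject₁ a))) (DirPath.vtx P (suc (suc a))) → DirPath T m
  shortcut P a forward = record
    { vtx  = vtx ∘ punchIn (suc (inject₁ a))
    ; inj  = punchIn-injective (suc (inject₁ a)) _ _ ∘ inj
    ; arcs = shortcut-IsWalk vtx a arcs forward
    }
    where open DirPath P

  shortest⇒backward-chord : ∀ {m} (P : DirPath T (suc m)) → Shortest T P → (a : Fin m) →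
                            Arc (DirPath.vtx P (suc (suc a))) (DirPath.vtx P (inject₁ (inject₁ a)))
  shortest⇒backward-chord {m} P shortest a
    with total (vtx (suc (suc a))) (vtx (inject₁ (inject₁ a)))
               (2-walk-ends-≢ (arcs (inject₁ a)) (arcs (suc a)))
    where open DirPath P
  ... | inj₁ backward = backward
  ... | inj₂ forward = ⊥-elim (shortest m (n<1+n m) (shortcut P a forward) refl
                                 (cong (DirPath.vtx P) (punchIn-inject₁-fromℕ (suc a))))

  shortest⇒vertex-in-NArc : ∀ {m} (P : DirPath T (3 + m)) → Shortest T P →
                            ∀ j → ∃ λ i → NArc T P i (DirPath.vtx P j)
  shortest⇒vertex-in-NArc P shortest zero =
    suc zero , shortest⇒backward-chord P shortest zero , DirPath.arcs P zero
  shortest⇒vertex-in-NArc P shortest (suc zero) =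
    suc (suc zero) , shortest⇒backward-chord P shortest (suc zero) , DirPath.arcs P (suc zero)
  shortest⇒vertex-in-NArc P shortest (suc (suc a)) =
    inject₁ a , DirPath.arcs P (suc a) , shortest⇒backward-chord P shortest a

lemma2p3 : ∀ {n : ℕ} (T : Tournament n) (k : ℕ) → 1 ≤ k →
    (P : DirPath T k) → Shortest T P →
    (∀ x → N⁻ T (start T P) x → N⁺ T (end T P) x → ∃ λ i → NArc T P i x)
    × (3 ≤ k → ∀ (j : Fin (suc k)) → ∃ λ i → NArc T P i (DirPath.vtx P j))
    × (k ≡ 2 → ∀ (i : Fin k) → (toℕ i ≡ 1 → NArc T P i (start T P))
                              × (toℕ i ≡ 0 → NArc T P i (end T P)))
lemma2p3 T k _ P shortest = crossing-arc T vtx arcs , vertices , lengthTwo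
  where
  open DirPath P
  vertices : 3 ≤ k → ∀ j → ∃ λ i → NArc T P i (vtx j)
  vertices (s≤s (s≤s (s≤s _))) = shortest⇒vertex-in-NArc T P shortest
  lengthTwo : k ≡ 2 → ∀ (i : Fin k) → (toℕ i ≡ 1 → NArc T P i (start T P))
                                     × (toℕ i ≡ 0 → NArc T P i (end T P))
  lengthTwo refl zero = (λ ()) , λ _ → arcs (suc zero) , shortest⇒backward-chord T P shortest zero
  lengthTwo refl (suc zero) = (λ _ → shortest⇒backward-chord T P shortest zero , arcs zero) , λ ()
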